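{- Let $n \ge 2$. Any directed Hamilton path in the directed Cayley graph $\Xi_n$ is in fact a Hamilton cycle, i.e., if $\Pi_1, \Pi_2, \ldots, \Pi_{n!}$ is a listing of all permutations of $\{1,\ldots,n\}$ with $\Pi_{i+1} \in \{\sigma_n \Pi_i, \sigma_{n-1}\Pi_i\}$ for $1 \le i < n!$, then $\Pi_1 \in \{\sigma_n \Pi_{n!}, \sigma_{n-1}\Pi_{n!}\}$.
   Context: For $1\le k\le n$, $\sigma_k = (1\ 2\ \cdots\ k)$ is the $k$-cycle in the symmetric group $\mathbb{S}_n$. The directed Cayley graph $\Xi_n = \overrightarrow{\mathrm{Cay}}(\{\sigma_n,\sigma_{n-1}\} : \mathbb{S}_n)$ has as vertices all permutations of $\{1,\ldots,n\}$ and directed edges $g \to \sigma_n g$ and $g \to \sigma_{n-1} g$. -}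

module Defs where

open import Data.Nat using (ℕ; zero; suc; _<_; _≤_; _!)
open import Data.Fin using (Fin; toℕ; fromℕ<; inject₁) renaming (zero to fzero; suc to fsuc)
open import Data.Fin.Permutation using (Permutation′; _⟨$⟩ʳ_; _≈_)
open import Data.Product using (Σ; _×_; _,_)
open import Data.Sum using (_⊎_)
open import Relation.Binary.PropositionalEquality using (_≡_)
import Data.Nat
import Relation.Nullary

-- Points 1..n of the paper are represented by Fin n as 0..n-1 (point j ↦ j-1).
-- The k-cycle σ_k = (1 2 ... k) maps j ↦ j+1 for 1 ≤ j < k, k ↦ 1, and fixes j > k.
cycleFun : {n : ℕ} → ℕ → Fin n → Fin n
cycleFun {suc n} k i with Data.Nat._<?_ (suc (toℕ i)) k
... | Relation.Nullary.yes _ with Data.Nat._<?_ (suc (toℕ i)) (suc n)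
...   | Relation.Nullary.yes p = fromℕ< p
...   | Relation.Nullary.no _ = i
cycleFun {suc n} k i | Relation.Nullary.no _ with Data.Nat._≟_ (suc (toℕ i)) k
...   | Relation.Nullary.yes _ = fzero
...   | Relation.Nullary.no _ = i

IsLeftMul : {n : ℕ} → ℕ → Permutation′ n → Permutation′ n → Set
IsLeftMul {n} k g h = ∀ (x : Fin n) → h ⟨$⟩ʳ x ≡ cycleFun {n} k (g ⟨$⟩ʳ x)

Edge : (n : ℕ) → Permutation′ n → Permutation′ n → Set
Edge n g h = IsLeftMul n g h ⊎ IsLeftMul (Data.Nat._∸_ n 1) g h

IsListing : (n : ℕ) → (Fin (n !) → Permutation′ n) → Set
IsListing n Π =
  (∀ (i j : Fin (n !)) → Π i ≈ Π j → i ≡ j) ×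
  (∀ (g : Permutation′ n) → Σ (Fin (n !)) (λ i → Π i ≈ g))

IsDirectedPath : (n : ℕ) → (Fin (n !) → Permutation′ n) → Set
IsDirectedPath n Π = ∀ (i : Fin (n !)) (j : Fin (n !)) → toℕ j ≡ suc (toℕ i) → Edge n (Π i) (Π j)

-- With τ the transposition of the last two points, σₙ = σₙ₋₁τ and σₙ₋₁ = σₙτ. Let L be the last
-- vertex of the path. Since L has no successor, a vertex σL with σ ∈ {σₙ, σₙ₋₁} that is not the
-- first one is entered from its predecessor through the other generator, so that predecessor is τL.
-- If neither σₙL nor σₙ₋₁L were first, both would follow τL, forcing σₙL = σₙ₋₁L.
module Submission where

open import Defs
open import Data.Nat using (ℕ; zero; suc; _≤_; _<_; _∸_; _!; z≤n; s≤s; _<?_; _≤?_; _≟_)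
open import Data.Nat.Properties
  using ( <-cmp; <-irrefl; <-≤-trans; ≤-refl; ≤-reflexive; ≤-antisym; n≤1+n; <⇒≢; <⇒≱; ≰⇒>; ≤-pred
        ; m≤n⇒m≤1+n; m+[n∸m]≡n; ∸-monoˡ-≤; suc-injective)
import Data.Fin
open import Data.Fin using (Fin; toℕ; fromℕ<; inject₁) renaming (zero to fzero; suc to fsuc)
open import Data.Fin.Properties using (toℕ-fromℕ<; toℕ-inject₁; toℕ-injective; toℕ<n)
open import Data.Fin.Permutation
  using (Permutation′; permutation; _⟨$⟩ʳ_; _⟨$⟩ˡ_; _≈_; inverseʳ; inverseˡ)
open import Data.Product using (∃; _×_; _,_; proj₁; proj₂)
open import Data.Sum using (_⊎_; inj₁; inj₂; swap)
open import Function.Definitions using (Injective)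
open import Relation.Binary.Definitions using (tri<; tri≈; tri>)
open import Relation.Binary.PropositionalEquality
  using (_≡_; _≢_; _≗_; refl; sym; trans; cong; subst; module ≡-Reasoning)
open import Relation.Nullary using (yes; no; ¬_; contradiction)
open import Function using (_∘_)

cycleFun-step : ∀ {n} k (i : Fin n) {t} → toℕ i ≡ t → suc t < k → suc t < n →
                toℕ (cycleFun k i) ≡ suc t
cycleFun-step {suc n} k i refl t+1<k t+1<n with suc (toℕ i) <? k
... | no t+1≮k = contradiction t+1<k t+1≮k
... | yes _ with suc (toℕ i) <? suc n
...   | yes t+1<n′ = toℕ-fromℕ< t+1<n′
...   | no t+1≮n = contradiction t+1<n t+1≮n

cycleFun-wrap : ∀ {n} k (i : Fin n) → suc (toℕ i) ≡ k → toℕ (cycleFun k i) ≡ 0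
cycleFun-wrap {suc n} k i i+1≡k with suc (toℕ i) <? k
... | yes i+1<k = contradiction i+1≡k (<⇒≢ i+1<k)
... | no _ with suc (toℕ i) ≟ k
...   | yes _ = refl
...   | no i+1≢k = contradiction i+1≡k i+1≢k

cycleFun-fixes : ∀ {n} k (i : Fin n) → k ≤ toℕ i → cycleFun k i ≡ i
cycleFun-fixes {suc n} k i k≤i with suc (toℕ i) <? k
... | yes i+1<k = contradiction (m≤n⇒m≤1+n k≤i) (<⇒≱ i+1<k)
... | no _ with suc (toℕ i) ≟ k
...   | yes i+1≡k = contradiction (s≤s k≤i) (<-irrefl (sym i+1≡k))
...   | no _ = refl

cycleInv : ∀ {n} → ℕ → Fin n → Fin n
cycleInv {suc n} k fzero with k ∸ 1 <? suc n
... | yes k-1<n = fromℕ< k-1<n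
... | no _ = fzero
cycleInv k (fsuc j) with suc (toℕ j) <? k
... | yes _ = inject₁ j
... | no _ = fsuc j

cycleInv-zero : ∀ {n} k (i : Fin n) → k ≤ n → toℕ i ≡ 0 → toℕ (cycleInv k i) ≡ k ∸ 1
cycleInv-zero {suc n} k fzero k≤n refl with k ∸ 1 <? suc n
... | yes k-1<n = toℕ-fromℕ< k-1<n
... | no k-1≮n = contradiction (s≤s (∸-monoˡ-≤ 1 k≤n)) k-1≮n

cycleInv-step : ∀ {n} k (i : Fin n) {t} → toℕ i ≡ suc t → suc t < k → toℕ (cycleInv k i) ≡ t
cycleInv-step k (fsuc j) refl j+1<k with suc (toℕ j) <? k
... | yes _ = toℕ-inject₁ j
... | no j+1≮k = contradiction j+1<k j+1≮k

cycleInv-fixes : ∀ {n} k (i : Fin n) → 1 ≤ k → k ≤ toℕ i → cycleInv k i ≡ i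
cycleInv-fixes k fzero 1≤k k≤0 = contradiction k≤0 (<⇒≱ 1≤k)
cycleInv-fixes k (fsuc j) _ k≤j+1 with suc (toℕ j) <? k
... | yes j+1<k = contradiction k≤j+1 (<⇒≱ j+1<k)
... | no _ = refl

cycleFun-cycleInv : ∀ {n} k → 1 ≤ k → k ≤ n → (i : Fin n) → cycleFun k (cycleInv k i) ≡ i
cycleFun-cycleInv k 1≤k k≤n fzero =
  toℕ-injective (cycleFun-wrap k _ (trans (cong suc (cycleInv-zero k fzero k≤n refl)) (m+[n∸m]≡n 1≤k)))
cycleFun-cycleInv k 1≤k k≤n (fsuc j) with k ≤? suc (toℕ j)
... | yes k≤j+1 =
  trans (cong (cycleFun k) (cycleInv-fixes k (fsuc j) 1≤k k≤j+1)) (cycleFun-fixes k (fsuc j) k≤j+1)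
... | no k≰j+1 =
  toℕ-injective (cycleFun-step k _ (cycleInv-step k (fsuc j) refl (≰⇒> k≰j+1)) (≰⇒> k≰j+1) (toℕ<n (fsuc j)))

cycleInv-cycleFun : ∀ {n} k → 1 ≤ k → k ≤ n → (i : Fin n) → cycleInv k (cycleFun k i) ≡ i
cycleInv-cycleFun k 1≤k k≤n i with <-cmp (suc (toℕ i)) k
... | tri< i+1<k _ _ =
  toℕ-injective (cycleInv-step k _ (cycleFun-step k i refl i+1<k (<-≤-trans i+1<k k≤n)) i+1<k)
... | tri≈ _ i+1≡k _ =
  toℕ-injective (trans (cycleInv-zero k _ k≤n (cycleFun-wrap k i i+1≡k)) (cong (_∸ 1) (sym i+1≡k)))
... | tri> _ _ k<i+1 =
  trans (cong (cycleInv k) (cycleFun-fixes k i (≤-pred k<i+1))) (cycleInv-fixes k i 1≤k (≤-pred k<i+1))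

cycleFun-injective : ∀ {n} k → 1 ≤ k → k ≤ n → Injective _≡_ _≡_ (cycleFun {n} k)
cycleFun-injective k 1≤k k≤n {i} {j} σi≡σj = begin
  i                          ≡⟨ sym (cycleInv-cycleFun k 1≤k k≤n i) ⟩
  cycleInv k (cycleFun k i)  ≡⟨ cong (cycleInv k) σi≡σj ⟩
  cycleInv k (cycleFun k j)  ≡⟨ cycleInv-cycleFun k 1≤k k≤n j ⟩
  j                          ∎
  where open ≡-Reasoning

cycleFun-∘ : ∀ {n} k → 1 ≤ k → k ≤ n → Permutation′ n → Permutation′ n
cycleFun-∘ k 1≤k k≤n g = permutation (λ x → cycleFun k (g ⟨$⟩ʳ x)) (λ y → g ⟨$⟩ˡ cycleInv k y)
  (λ y → trans (cong (cycleFun k) (inverseʳ g)) (cycleFun-cycleInv k 1≤k k≤n y))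
  (λ x → trans (cong (g ⟨$⟩ˡ_) (cycleInv-cycleFun k 1≤k k≤n (g ⟨$⟩ʳ x))) (inverseˡ g))

swapLast : ∀ m → Fin (suc (suc m)) → Fin (suc (suc m))
swapLast zero fzero = fsuc fzero
swapLast zero (fsuc fzero) = fzero
swapLast (suc m) fzero = fzero
swapLast (suc m) (fsuc i) = fsuc (swapLast m i)

swapLast-below : ∀ m (i : Fin (suc (suc m))) → toℕ i < m → swapLast m i ≡ i
swapLast-below (suc m) fzero _ = refl
swapLast-below (suc m) (fsuc i) i<m = cong fsuc (swapLast-below m i (≤-pred i<m))

toℕ-swapLast-penultimate : ∀ m (i : Fin (suc (suc m))) → toℕ i ≡ m → toℕ (swapLast m i) ≡ suc m
toℕ-swapLast-penultimate zero fzero refl = refl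
toℕ-swapLast-penultimate (suc m) (fsuc i) i≡m = cong suc (toℕ-swapLast-penultimate m i (suc-injective i≡m))

toℕ-swapLast-last : ∀ m (i : Fin (suc (suc m))) → toℕ i ≡ suc m → toℕ (swapLast m i) ≡ m
toℕ-swapLast-last zero (fsuc fzero) refl = refl
toℕ-swapLast-last (suc m) (fsuc i) i≡m+1 = cong suc (toℕ-swapLast-last m i (suc-injective i≡m+1))

position : ∀ m (i : Fin (suc (suc m))) → toℕ i < m ⊎ toℕ i ≡ m ⊎ toℕ i ≡ suc m
position m i with <-cmp (toℕ i) m
... | tri< i<m _ _ = inj₁ i<m
... | tri≈ _ i≡m _ = inj₂ (inj₁ i≡m)
... | tri> _ _ m<i = inj₂ (inj₂ (≤-antisym (≤-pred (toℕ<n i)) m<i))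

module Generators (m : ℕ) where

  σₙ σₙ₋₁ τ : Fin (suc (suc m)) → Fin (suc (suc m))
  σₙ = cycleFun (suc (suc m))
  σₙ₋₁ = cycleFun (suc m)
  τ = swapLast m

  σₙ-injective : Injective _≡_ _≡_ σₙ
  σₙ-injective = cycleFun-injective (suc (suc m)) (s≤s z≤n) ≤-refl

  σₙ₋₁-injective : Injective _≡_ _≡_ σₙ₋₁
  σₙ₋₁-injective = cycleFun-injective (suc m) (s≤s z≤n) (n≤1+n _)

  σₙ≗σₙ₋₁∘τ : σₙ ≗ σₙ₋₁ ∘ τ
  σₙ≗σₙ₋₁∘τ i with position m i
  ... | inj₁ i<m = toℕ-injective (trans
        (cycleFun-step _ i refl (s≤s (m≤n⇒m≤1+n i<m)) (s≤s (m≤n⇒m≤1+n i<m)))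
        (sym (cycleFun-step _ (τ i) (cong toℕ (swapLast-below m i i<m)) (s≤s i<m) (s≤s (m≤n⇒m≤1+n i<m)))))
  ... | inj₂ (inj₁ i≡m) = toℕ-injective (trans
        (cycleFun-step _ i i≡m ≤-refl ≤-refl)
        (sym (trans (cong toℕ (cycleFun-fixes _ (τ i) (≤-reflexive (sym τi≡m+1)))) τi≡m+1)))
    where τi≡m+1 = toℕ-swapLast-penultimate m i i≡m
  ... | inj₂ (inj₂ i≡m+1) = toℕ-injective (trans
        (cycleFun-wrap _ i (cong suc i≡m+1))
        (sym (cycleFun-wrap _ (τ i) (cong suc (toℕ-swapLast-last m i i≡m+1)))))

  σₙ₋₁≗σₙ∘τ : σₙ₋₁ ≗ σₙ ∘ τ
  σₙ₋₁≗σₙ∘τ i with position m i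
  ... | inj₁ i<m = toℕ-injective (trans
        (cycleFun-step _ i refl (s≤s i<m) (s≤s (m≤n⇒m≤1+n i<m)))
        (sym (cycleFun-step _ (τ i) (cong toℕ (swapLast-below m i i<m))
                            (s≤s (m≤n⇒m≤1+n i<m)) (s≤s (m≤n⇒m≤1+n i<m)))))
  ... | inj₂ (inj₁ i≡m) = toℕ-injective (trans
        (cycleFun-wrap _ i (cong suc i≡m))
        (sym (cycleFun-wrap _ (τ i) (cong suc (toℕ-swapLast-penultimate m i i≡m)))))
  ... | inj₂ (inj₂ i≡m+1) = toℕ-injective (trans
        (cong toℕ (cycleFun-fixes _ i (≤-reflexive (sym i≡m+1))))
        (trans i≡m+1 (sym (cycleFun-step _ (τ i) (toℕ-swapLast-last m i i≡m+1) ≤-refl ≤-refl))))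

  σₙ∘_ σₙ₋₁∘_ : Permutation′ (suc (suc m)) → Permutation′ (suc (suc m))
  σₙ∘_ = cycleFun-∘ (suc (suc m)) (s≤s z≤n) ≤-refl
  σₙ₋₁∘_ = cycleFun-∘ (suc m) (s≤s z≤n) (n≤1+n _)

  σₙ∘≉σₙ₋₁∘ : (g : Permutation′ (suc (suc m))) → ¬ (σₙ∘ g ≈ σₙ₋₁∘ g)
  σₙ∘≉σₙ₋₁∘ g σₙg≈σₙ₋₁g = contradiction (begin
      suc m             ≡⟨ sym (cycleFun-step _ p p≡m ≤-refl ≤-refl) ⟩
      toℕ (σₙ p)        ≡⟨ cong toℕ σₙp≡σₙ₋₁p ⟩
      toℕ (σₙ₋₁ p)      ≡⟨ cycleFun-wrap _ p (cong suc p≡m) ⟩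
      0                 ∎) λ ()
    where
    open ≡-Reasoning
    p = fromℕ< (n≤1+n (suc m))
    p≡m = toℕ-fromℕ< (n≤1+n (suc m))
    σₙp≡σₙ₋₁p : σₙ p ≡ σₙ₋₁ p
    σₙp≡σₙ₋₁p = subst (λ y → σₙ y ≡ σₙ₋₁ y) (inverseʳ g) (σₙg≈σₙ₋₁g (g ⟨$⟩ˡ p))

predecessor : ∀ {M} (j : Fin M) → toℕ j ≢ 0 → ∃ λ (i : Fin M) → toℕ j ≡ suc (toℕ i)
predecessor fzero j≢0 = contradiction refl j≢0
predecessor (fsuc j) _ = inject₁ j , cong suc (sym (toℕ-inject₁ j))

last-hasNoSuccessor : ∀ {M} {i j last : Fin M} → suc (toℕ last) ≡ M → toℕ j ≡ suc (toℕ i) → i ≢ last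
last-hasNoSuccessor {j = j} isLast j≡i+1 refl = <-irrefl (trans j≡i+1 isLast) (toℕ<n j)

IsLeftMul-cancelˡ : ∀ {n} k {g g′ h : Permutation′ n} → Injective _≡_ _≡_ (cycleFun {n} k) →
                    IsLeftMul k g h → IsLeftMul k g′ h → g ≈ g′
IsLeftMul-cancelˡ k σ-injective h≡σg h≡σg′ x = σ-injective (trans (sym (h≡σg x)) (h≡σg′ x))

module LastVertex {m} (Π : Fin (suc (suc m) !) → Permutation′ (suc (suc m)))
                  (listing : IsListing (suc (suc m)) Π)
                  (path : IsDirectedPath (suc (suc m)) Π)
                  (last : Fin (suc (suc m) !)) (isLast : suc (toℕ last) ≡ suc (suc m) !) where

  open Generators m

  L : Permutation′ (suc (suc m))
  L = Π last

  index : Permutation′ (suc (suc m)) → Fin (suc (suc m) !)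
  index g = proj₁ (proj₂ listing g)

  Π-index : ∀ g → Π (index g) ≈ g
  Π-index g = proj₂ (proj₂ listing g)

  enteredFrom-τ∘L : ∀ a b → Injective _≡_ _≡_ (cycleFun {suc (suc m)} a) →
                    Injective _≡_ _≡_ (cycleFun {suc (suc m)} b) →
                    cycleFun a ≗ cycleFun b ∘ τ →
                    (∀ i j → toℕ j ≡ suc (toℕ i) → IsLeftMul a (Π i) (Π j) ⊎ IsLeftMul b (Π i) (Π j)) →
                    ∀ j → toℕ j ≢ 0 → IsLeftMul a L (Π j) →
                    ∃ λ i → toℕ j ≡ suc (toℕ i) × (∀ x → Π i ⟨$⟩ʳ x ≡ τ (L ⟨$⟩ʳ x))
  enteredFrom-τ∘L a b a-injective b-injective a≗b∘τ edge j j≢0 Πj≡aL with predecessor j j≢0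
  ... | i , j≡i+1 = i , j≡i+1 , Πi≈τL (edge i j j≡i+1)
    where
    Πi≈τL : IsLeftMul a (Π i) (Π j) ⊎ IsLeftMul b (Π i) (Π j) → ∀ x → Π i ⟨$⟩ʳ x ≡ τ (L ⟨$⟩ʳ x)
    Πi≈τL (inj₁ Πj≡aΠi) = contradiction
      (proj₁ listing i last (IsLeftMul-cancelˡ a {Π i} {L} {Π j} a-injective Πj≡aΠi Πj≡aL))
      (last-hasNoSuccessor isLast j≡i+1)
    Πi≈τL (inj₂ Πj≡bΠi) x =
      b-injective (trans (sym (Πj≡bΠi x)) (trans (Πj≡aL x) (a≗b∘τ (L ⟨$⟩ʳ x))))

  J K : Fin (suc (suc m) !)
  J = index (σₙ∘ L)
  K = index (σₙ₋₁∘ L)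

  J≡K : toℕ J ≢ 0 → toℕ K ≢ 0 → J ≡ K
  J≡K J≢0 K≢0
    with enteredFrom-τ∘L (suc (suc m)) (suc m) σₙ-injective σₙ₋₁-injective σₙ≗σₙ₋₁∘τ
                          path J J≢0 (Π-index (σₙ∘ L))
       | enteredFrom-τ∘L (suc m) (suc (suc m)) σₙ₋₁-injective σₙ-injective σₙ₋₁≗σₙ∘τ
                          (λ i j j≡i+1 → swap (path i j j≡i+1)) K K≢0 (Π-index (σₙ₋₁∘ L))
  ... | i , J≡i+1 , Πi≈τL | i′ , K≡i′+1 , Πi′≈τL = toℕ-injective (begin
      toℕ J         ≡⟨ J≡i+1 ⟩
      suc (toℕ i)   ≡⟨ cong (suc ∘ toℕ) i≡i′ ⟩
      suc (toℕ i′)  ≡⟨ sym K≡i′+1 ⟩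
      toℕ K         ∎)
    where
    open ≡-Reasoning
    i≡i′ : i ≡ i′
    i≡i′ = proj₁ listing i i′ (λ x → trans (Πi≈τL x) (sym (Πi′≈τL x)))

  edgeToFirst : (first : Fin (suc (suc m) !)) → toℕ first ≡ 0 → Edge (suc (suc m)) L (Π first)
  edgeToFirst first first≡0 with toℕ J ≟ 0 | toℕ K ≟ 0
  ... | yes J≡0 | _ =
    inj₁ (subst (λ j → Π j ≈ σₙ∘ L) (toℕ-injective (trans J≡0 (sym first≡0))) (Π-index (σₙ∘ L)))
  ... | no _ | yes K≡0 =
    inj₂ (subst (λ j → Π j ≈ σₙ₋₁∘ L) (toℕ-injective (trans K≡0 (sym first≡0))) (Π-index (σₙ₋₁∘ L)))
  ... | no J≢0 | no K≢0 = contradiction σₙL≈σₙ₋₁L (σₙ∘≉σₙ₋₁∘ L)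
    where
    σₙL≈σₙ₋₁L : σₙ∘ L ≈ σₙ₋₁∘ L
    σₙL≈σₙ₋₁L x = trans (sym (Π-index (σₙ∘ L) x))
                        (trans (cong (λ j → Π j ⟨$⟩ʳ x) (J≡K J≢0 K≢0)) (Π-index (σₙ₋₁∘ L) x))

lemma1 : (n : ℕ) → 2 ≤ n → (Π : Fin (n !) → Permutation′ n)
    → IsListing n Π → IsDirectedPath n Π
    → (first last : Fin (n !)) → Data.Fin.toℕ first ≡ 0 → suc (Data.Fin.toℕ last) ≡ n !
    → Edge n (Π last) (Π first)
lemma1 (suc zero) (s≤s ())
lemma1 (suc (suc m)) _ Π listing path first last first≡0 isLast =
  LastVertex.edgeToFirst Π listing path last isLast first first≡0
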